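{- Let $p,q$ be primes with $q\mid p-1$, and let $G$ be the unique multiplicative subgroup of $\mathbb{F}_p^*$ of order $q$. Let $k\le q$, let $\alpha_1,\dots,\alpha_k\in\mathbb{F}_q$ be distinct and $\beta_1,\dots,\beta_k\in\mathbb{F}_p$. For $c\in\{1,2,\dots,q-1\}$ let \[f_c(z)=\beta_1z^{c\alpha_1\bmod q}+\beta_2z^{c\alpha_2\bmod q}+\dots+\beta_kz^{c\alpha_k\bmod q}\in\mathbb{F}_p[z].\] Then all the polynomials $f_1,f_2,\dots,f_{q-1}$ have the same number of roots in $G$.
   Context: Each $\alpha_i\in\mathbb{F}_q$ is identified with its representative in $\{0,\dots,q-1\}$, and $c\alpha_i\bmod q$ denotes the representative in $\{0,\dots,q-1\}$ of the product. -}

module Defs where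

open import Data.Nat using (ℕ; zero; suc; _+_; _*_; _^_; NonZero)
open import Data.Nat.DivMod using (_%_)
open import Data.Nat.Properties using (_≟_)
open import Data.Fin using (Fin; toℕ)
open import Data.List using (List; map; length; filter; allFin)
open import Data.Nat.ListAction using (sum)
open import Data.Product using (_×_)
open import Relation.Binary.PropositionalEquality using (_≡_)
open import Relation.Nullary.Decidable using (_×-dec_)

-- Elements of F_p are represented by Fin p (values 0..p-1), elements of
-- F_q by Fin q.  The exponent  c·α mod q  is the representative in {0..q-1}.

evalF : (p q k : ℕ) .{{_ : NonZero p}} .{{_ : NonZero q}} →
        (α : Fin k → Fin q) (β : Fin k → Fin p) (c : ℕ) (z : Fin p) → ℕ
evalF p q k α β c z =
  sum (map (λ i → toℕ (β i) * toℕ z ^ ((c * toℕ (α i)) % q)) (allFin k)) % p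

-- Membership in G: the subgroup of order q of F_p^*, i.e. { z : z^q = 1 }.
InG : (p q : ℕ) .{{_ : NonZero p}} → Fin p → Set
InG p q z = toℕ z ^ q % p ≡ 1

numRootsInG : (p q k : ℕ) .{{_ : NonZero p}} .{{_ : NonZero q}} →
              (α : Fin k → Fin q) (β : Fin k → Fin p) (c : ℕ) → ℕ
numRootsInG p q k α β c =
  length (filter (λ z → (toℕ z ^ q % p ≟ 1) ×-dec (evalF p q k α β c z ≟ 0)) (allFin p))

-- For c invertible modulo q, say c·e ≡ 1 (mod q), the map z ↦ z^c is a
-- permutation of G with inverse z ↦ z^e, because z^q = 1 lets exponents be
-- reduced modulo q.  The same reduction gives f_c(z) = f_1(z^c) on G, so
-- z ↦ z^c carries the roots of f_c in G bijectively onto those of f_1.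
module Submission where

open import Defs
open import Data.Nat using (ℕ; zero; suc; _+_; _*_; _^_; _≤_; _<_; _∸_; NonZero; >-nonZero)
open import Data.Nat.Properties
open import Data.Nat.DivMod using (_%_; _/_; %-distribˡ-+; %-distribˡ-*; m%n%n≡m%n; m≡m%n+[m/n]*n; [m+kn]%n≡m%n; m%n<n; m<n⇒m%n≡m; m*n%n≡0)
open import Data.Nat.Divisibility using (_∣_)
open import Data.Nat.Primality using (Prime)
open import Data.Nat.GCD using (module Bézout)
open import Data.Nat.Coprimality using (Coprime; coprime-Bézout; prime⇒coprime)
open import Data.Nat.ListAction using (sum)
open import Data.Nat.Tactic.RingSolver using (solve-∀)
open import Data.Bool.Base using (Bool; true; false; if_then_else_)
open import Data.Fin using (Fin; toℕ; fromℕ<)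
open import Data.Fin.Properties using (toℕ<n; toℕ-fromℕ<; toℕ-injective)
open import Data.Fin.Permutation using (Permutation′; _⟨$⟩ʳ_; permutation)
open import Data.List using (List; []; _∷_; map; length; filter; allFin; tabulate)
open import Data.Product using (_×_; _,_; ∃-syntax)
open import Data.Empty using (⊥-elim)
open import Function.Bundles using (_⇔_; mk⇔)
open import Function.Definitions using (Injective)
open import Relation.Nullary using (Dec; yes; no; does; ¬_)
open import Relation.Nullary.Decidable using (_×-dec_; does-⇔)
open import Relation.Unary using (Pred; Decidable)
open import Relation.Binary.PropositionalEquality
  using (_≡_; refl; sym; trans; cong; cong₂; module ≡-Reasoning)
import Algebra.Properties.CommutativeMonoid.Sum as CommutativeMonoidSum

module FinSum = CommutativeMonoidSum +-0-commutativeMonoid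

indicator : Bool → ℕ
indicator b = if b then 1 else 0

length-filter-tabulate : ∀ {n ℓ} {A : Set} {P : Pred A ℓ} (P? : Decidable P) (f : Fin n → A) →
  length (filter P? (tabulate f)) ≡ FinSum.sum (λ i → indicator (does (P? (f i))))
length-filter-tabulate {zero} P? f = refl
length-filter-tabulate {suc n} P? f with does (P? (f Fin.zero))
... | true  = cong suc (length-filter-tabulate P? (λ i → f (Fin.suc i)))
... | false = length-filter-tabulate P? (λ i → f (Fin.suc i))

length-filter-allFin-permute : ∀ {n ℓ₁ ℓ₂} {P : Pred (Fin n) ℓ₁} {Q : Pred (Fin n) ℓ₂}
  (P? : Decidable P) (Q? : Decidable Q) (π : Permutation′ n) →
  (∀ i → P i ⇔ Q (π ⟨$⟩ʳ i)) →
  length (filter P? (allFin n)) ≡ length (filter Q? (allFin n))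
length-filter-allFin-permute P? Q? π P⇔Qπ = begin
  length (filter P? (allFin _))
    ≡⟨ length-filter-tabulate P? (λ i → i) ⟩
  FinSum.sum (λ i → indicator (does (P? i)))
    ≡⟨ FinSum.sum-cong-≗ (λ i → cong indicator (does-⇔ (P⇔Qπ i) (P? i) (Q? _))) ⟩
  FinSum.sum (λ i → indicator (does (Q? (π ⟨$⟩ʳ i))))
    ≡⟨ FinSum.sum-permute (λ i → indicator (does (Q? i))) π ⟨
  FinSum.sum (λ i → indicator (does (Q? i)))
    ≡⟨ length-filter-tabulate Q? (λ i → i) ⟨
  length (filter Q? (allFin _))
    ∎
  where open ≡-Reasoning

infix 4 _≡_mod_
_≡_mod_ : ℕ → ℕ → (m : ℕ) .{{_ : NonZero m}} → Set
x ≡ y mod m = x % m ≡ y % m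

module _ {m : ℕ} .{{_ : NonZero m}} where
  open ≡-Reasoning

  %-≡-mod : ∀ x → x % m ≡ x mod m
  %-≡-mod x = m%n%n≡m%n x m

  +-cong-mod : ∀ {x x′ y y′} → x ≡ x′ mod m → y ≡ y′ mod m → x + y ≡ x′ + y′ mod m
  +-cong-mod {x} {x′} {y} {y′} x≡x′ y≡y′ = begin
    (x + y) % m             ≡⟨ %-distribˡ-+ x y m ⟩
    (x % m + y % m) % m     ≡⟨ cong₂ (λ u v → (u + v) % m) x≡x′ y≡y′ ⟩
    (x′ % m + y′ % m) % m   ≡⟨ %-distribˡ-+ x′ y′ m ⟨
    (x′ + y′) % m           ∎

  *-cong-mod : ∀ {x x′ y y′} → x ≡ x′ mod m → y ≡ y′ mod m → x * y ≡ x′ * y′ mod m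
  *-cong-mod {x} {x′} {y} {y′} x≡x′ y≡y′ = begin
    (x * y) % m             ≡⟨ %-distribˡ-* x y m ⟩
    (x % m * (y % m)) % m   ≡⟨ cong₂ (λ u v → (u * v) % m) x≡x′ y≡y′ ⟩
    (x′ % m * (y′ % m)) % m ≡⟨ %-distribˡ-* x′ y′ m ⟨
    (x′ * y′) % m           ∎

  ^-congˡ-mod : ∀ {x x′} n → x ≡ x′ mod m → x ^ n ≡ x′ ^ n mod m
  ^-congˡ-mod zero    x≡x′ = refl
  ^-congˡ-mod (suc n) x≡x′ = *-cong-mod x≡x′ (^-congˡ-mod n x≡x′)

  sum-map-cong-mod : ∀ {A : Set} {f g : A → ℕ} (xs : List A) →
    (∀ a → f a ≡ g a mod m) → sum (map f xs) ≡ sum (map g xs) mod m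
  sum-map-cong-mod []       f≡g = refl
  sum-map-cong-mod (a ∷ xs) f≡g = +-cong-mod (f≡g a) (sum-map-cong-mod xs f≡g)

  ^-reduce-exponent : ∀ {x} n .{{_ : NonZero n}} → x ^ n ≡ 1 mod m →
    ∀ j → x ^ j ≡ x ^ (j % n) mod m
  ^-reduce-exponent {x} n xⁿ≡1 j = begin
    x ^ j % m                             ≡⟨ cong (λ t → x ^ t % m) (m≡m%n+[m/n]*n j n) ⟩
    x ^ (j % n + j / n * n) % m           ≡⟨ cong (_% m) (^-distribˡ-+-* x (j % n) (j / n * n)) ⟩
    x ^ (j % n) * x ^ (j / n * n) % m     ≡⟨ *-cong-mod {x ^ (j % n)} refl x^[j/n*n]≡1 ⟩
    x ^ (j % n) * 1 % m                   ≡⟨ cong (_% m) (*-identityʳ (x ^ (j % n))) ⟩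
    x ^ (j % n) % m                       ∎
    where
    x^[j/n*n]≡1 : x ^ (j / n * n) ≡ 1 mod m
    x^[j/n*n]≡1 = begin
      x ^ (j / n * n) % m   ≡⟨ cong (λ t → x ^ t % m) (*-comm (j / n) n) ⟩
      x ^ (n * (j / n)) % m ≡⟨ cong (_% m) (^-*-assoc x n (j / n)) ⟨
      (x ^ n) ^ (j / n) % m ≡⟨ ^-congˡ-mod (j / n) xⁿ≡1 ⟩
      1 ^ (j / n) % m       ≡⟨ cong (_% m) (^-zeroˡ (j / n)) ⟩
      1 % m                 ∎

private
  u*u+[1+u]≡1+u*[1+u] : ∀ u → u * u + (1 + u) ≡ 1 + u * (1 + u)
  u*u+[1+u]≡1+u*[1+u] = solve-∀

  c*[y*[y*c]]≡[y*c]² : ∀ c y → c * (y * (y * c)) ≡ (y * c) * (y * c)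
  c*[y*[y*c]]≡[y*c]² = solve-∀

mod-inverse : ∀ q .{{_ : NonZero q}} {c} → Coprime q c → ∃[ e ] c * e ≡ 1 mod q
mod-inverse q {c} q⊥c with coprime-Bézout q⊥c
... | Bézout.-+ x y 1+xq≡yc = y , (begin
  (c * y) % q     ≡⟨ cong (_% q) (*-comm c y) ⟩
  (y * c) % q     ≡⟨ cong (_% q) 1+xq≡yc ⟨
  (1 + x * q) % q ≡⟨ [m+kn]%n≡m%n 1 x q ⟩
  1 % q           ∎)
  where open ≡-Reasoning
... | Bézout.+- x y 1+yc≡xq = y * (y * c) , (begin
  (c * (y * (y * c))) % q ≡⟨ cong (_% q) (c*[y*[y*c]]≡[y*c]² c y) ⟩
  (u * u) % q             ≡⟨ [m+kn]%n≡m%n (u * u) x q ⟨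
  (u * u + x * q) % q     ≡⟨ cong (λ t → (u * u + t) % q) 1+yc≡xq ⟨
  (u * u + (1 + u)) % q   ≡⟨ cong (_% q) (u*u+[1+u]≡1+u*[1+u] u) ⟩
  (1 + u * (1 + u)) % q   ≡⟨ cong (λ t → (1 + u * t) % q) 1+yc≡xq ⟩
  (1 + u * (x * q)) % q   ≡⟨ cong (λ t → (1 + t) % q) (*-assoc u x q) ⟨
  (1 + u * x * q) % q     ≡⟨ [m+kn]%n≡m%n 1 (u * x) q ⟩
  1 % q                   ∎)
  where
  open ≡-Reasoning
  -- 1 + y·c ≡ 0 (mod q) makes u ≡ -1, hence u² ≡ 1.
  u : ℕ
  u = y * c

module _ (p q : ℕ) .{{_ : NonZero p}} .{{_ : NonZero q}} where
  open ≡-Reasoning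

  InG? : Decidable (InG p q)
  InG? z = toℕ z ^ q % p ≟ 1

  -- Membership in G pins the representative of z^q to 1, which rules out p = 1.
  InG⇒1%p≡1 : ∀ {z} → InG p q z → 1 % p ≡ 1
  InG⇒1%p≡1 {z} zᵠ≡1 = begin
    1 % p                 ≡⟨ cong (_% p) zᵠ≡1 ⟨
    toℕ z ^ q % p % p     ≡⟨ m%n%n≡m%n (toℕ z ^ q) p ⟩
    toℕ z ^ q % p         ≡⟨ zᵠ≡1 ⟩
    1                     ∎

  InG⇒^q≡1 : ∀ {z} → InG p q z → toℕ z ^ q ≡ 1 mod p
  InG⇒^q≡1 zᵠ≡1 = trans zᵠ≡1 (sym (InG⇒1%p≡1 zᵠ≡1))

  ^-^-inG : ∀ {z} → InG p q z → ∀ c d → (toℕ z ^ c % p) ^ d ≡ toℕ z ^ ((c * d) % q) mod p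
  ^-^-inG {z} z∈G c d = begin
    (toℕ z ^ c % p) ^ d % p   ≡⟨ ^-congˡ-mod d (%-≡-mod {p} (toℕ z ^ c)) ⟩
    (toℕ z ^ c) ^ d % p       ≡⟨ cong (_% p) (^-*-assoc (toℕ z) c d) ⟩
    toℕ z ^ (c * d) % p       ≡⟨ ^-reduce-exponent q (InG⇒^q≡1 z∈G) (c * d) ⟩
    toℕ z ^ ((c * d) % q) % p ∎

  power : ℕ → Fin p → Fin p
  power c z = fromℕ< (m%n<n (toℕ z ^ c) p)

  power-inG : ∀ {z} c → InG p q z → InG p q (power c z)
  power-inG {z} c z∈G = begin
    toℕ (power c z) ^ q % p     ≡⟨ cong (λ t → t ^ q % p) (toℕ-fromℕ< _) ⟩
    (toℕ z ^ c % p) ^ q % p     ≡⟨ ^-^-inG z∈G c q ⟩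
    toℕ z ^ ((c * q) % q) % p   ≡⟨ cong (λ t → toℕ z ^ t % p) (m*n%n≡0 c q) ⟩
    1 % p                       ≡⟨ InG⇒1%p≡1 z∈G ⟩
    1                           ∎

  power-power-inverse : ∀ {z c e} → InG p q z → c * e ≡ 1 mod q → power e (power c z) ≡ z
  power-power-inverse {z} {c} {e} z∈G ce≡1 = toℕ-injective (begin
    toℕ (power e (power c z))     ≡⟨ toℕ-fromℕ< _ ⟩
    toℕ (power c z) ^ e % p       ≡⟨ cong (λ t → t ^ e % p) (toℕ-fromℕ< _) ⟩
    (toℕ z ^ c % p) ^ e % p       ≡⟨ ^-^-inG z∈G c e ⟩
    toℕ z ^ ((c * e) % q) % p     ≡⟨ cong (λ t → toℕ z ^ t % p) ce≡1 ⟩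
    toℕ z ^ (1 % q) % p           ≡⟨ ^-reduce-exponent q (InG⇒^q≡1 z∈G) 1 ⟨
    toℕ z ^ 1 % p                 ≡⟨ cong (_% p) (^-identityʳ (toℕ z)) ⟩
    toℕ z % p                     ≡⟨ m<n⇒m%n≡m (toℕ<n z) ⟩
    toℕ z                         ∎)

  -- Extended by the identity outside G, so that it permutes all of Fin p.
  powerOnG : ℕ → Fin p → Fin p
  powerOnG c z with InG? z
  ... | yes _ = power c z
  ... | no  _ = z

  powerOnG-∈G : ∀ c {z} → InG p q z → powerOnG c z ≡ power c z
  powerOnG-∈G c {z} z∈G with InG? z
  ... | yes _   = refl
  ... | no  z∉G = ⊥-elim (z∉G z∈G)

  powerOnG-∉G : ∀ c {z} → ¬ InG p q z → powerOnG c z ≡ z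
  powerOnG-∉G c {z} z∉G with InG? z
  ... | yes z∈G = ⊥-elim (z∉G z∈G)
  ... | no  _   = refl

  powerOnG-inverse : ∀ {c e} → c * e ≡ 1 mod q → ∀ z → powerOnG e (powerOnG c z) ≡ z
  powerOnG-inverse {c} {e} ce≡1 z = by-membership (InG? z)
    where
    by-membership : Dec (InG p q z) → powerOnG e (powerOnG c z) ≡ z
    by-membership (yes z∈G) = begin
      powerOnG e (powerOnG c z) ≡⟨ cong (powerOnG e) (powerOnG-∈G c z∈G) ⟩
      powerOnG e (power c z)    ≡⟨ powerOnG-∈G e (power-inG c z∈G) ⟩
      power e (power c z)       ≡⟨ power-power-inverse {c = c} {e} z∈G ce≡1 ⟩
      z                         ∎
    by-membership (no z∉G) = trans (cong (powerOnG e) (powerOnG-∉G c z∉G)) (powerOnG-∉G e z∉G)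

module _ (p q k : ℕ) .{{_ : NonZero p}} .{{_ : NonZero q}}
         (α : Fin k → Fin q) (β : Fin k → Fin p) where
  open ≡-Reasoning

  RootInG : ℕ → Pred (Fin p) _
  RootInG c z = InG p q z × evalF p q k α β c z ≡ 0

  RootInG? : ∀ c → Decidable (RootInG c)
  RootInG? c z = InG? p q z ×-dec (evalF p q k α β c z ≟ 0)

  evalF-power : ∀ c {z} → InG p q z → evalF p q k α β c z ≡ evalF p q k α β 1 (power p q c z)
  evalF-power c {z} z∈G = sum-map-cong-mod (allFin k) monomial-power
    where
    monomial-power : ∀ i → toℕ (β i) * toℕ z ^ ((c * toℕ (α i)) % q)
                         ≡ toℕ (β i) * toℕ (power p q c z) ^ ((1 * toℕ (α i)) % q) mod p
    monomial-power i = *-cong-mod {p} {toℕ (β i)} refl (sym (begin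
      toℕ (power p q c z) ^ ((1 * a) % q) % p ≡⟨ cong₂ (λ u v → u ^ v % p) (toℕ-fromℕ< _) [1*a]%q≡a ⟩
      (toℕ z ^ c % p) ^ a % p                 ≡⟨ ^-^-inG p q z∈G c a ⟩
      toℕ z ^ ((c * a) % q) % p               ∎))
      where
      a : ℕ
      a = toℕ (α i)
      [1*a]%q≡a : (1 * a) % q ≡ a
      [1*a]%q≡a = trans (cong (_% q) (*-identityˡ a)) (m<n⇒m%n≡m (toℕ<n (α i)))

  RootInG-powerOnG : ∀ c z → RootInG c z ⇔ RootInG 1 (powerOnG p q c z)
  RootInG-powerOnG c z = by-membership (InG? p q z)
    where
    by-membership : Dec (InG p q z) → RootInG c z ⇔ RootInG 1 (powerOnG p q c z)
    by-membership (yes z∈G) rewrite powerOnG-∈G p q c z∈G = mk⇔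
      (λ (_ , fᶜz≡0) → power-inG p q c z∈G , trans (sym (evalF-power c z∈G)) fᶜz≡0)
      (λ (_ , f¹zᶜ≡0) → z∈G , trans (evalF-power c z∈G) f¹zᶜ≡0)
    by-membership (no z∉G) rewrite powerOnG-∉G p q c z∉G = mk⇔
      (λ (z∈G , _) → ⊥-elim (z∉G z∈G))
      (λ (z∈G , _) → ⊥-elim (z∉G z∈G))

  numRootsInG-invertible : ∀ c → ∃[ e ] c * e ≡ 1 mod q →
    numRootsInG p q k α β c ≡ numRootsInG p q k α β 1
  numRootsInG-invertible c (e , ce≡1) =
    length-filter-allFin-permute (RootInG? c) (RootInG? 1) π (RootInG-powerOnG c)
    where
    ec≡1 : e * c ≡ 1 mod q
    ec≡1 = trans (cong (_% q) (*-comm e c)) ce≡1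
    π : Permutation′ p
    π = permutation (powerOnG p q c) (powerOnG p q e)
          (powerOnG-inverse p q ec≡1) (powerOnG-inverse p q ce≡1)

proposition5p4 : (p q : ℕ) .{{_ : NonZero p}} .{{_ : NonZero q}} →
    Prime p → Prime q → q ∣ p ∸ 1 →
    (k : ℕ) → k ≤ q →
    (α : Fin k → Fin q) → Injective _≡_ _≡_ α →
    (β : Fin k → Fin p) →
    (c c′ : ℕ) → 1 ≤ c → c < q → 1 ≤ c′ → c′ < q →
    numRootsInG p q k α β c ≡ numRootsInG p q k α β c′
proposition5p4 p q _ q-prime _ k _ α _ β c c′ 1≤c c<q 1≤c′ c′<q =
  trans (numRootsInG≡numRootsInG₁ 1≤c c<q) (sym (numRootsInG≡numRootsInG₁ 1≤c′ c′<q))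
  where
  numRootsInG≡numRootsInG₁ : ∀ {d} → 1 ≤ d → d < q → numRootsInG p q k α β d ≡ numRootsInG p q k α β 1
  numRootsInG≡numRootsInG₁ {d} 1≤d d<q =
    numRootsInG-invertible p q k α β d (mod-inverse q (prime⇒coprime q-prime {{>-nonZero 1≤d}} d<q))
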